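{- Let $n,\delta\in\mathbb{N}$ with $n>15\delta+3$ and $\delta\ge 4$. If $X=(n_0,n_1,\ldots,n_r)$ is a finite sequence of nonnegative integers satisfying (B1) $n_0=1$; (B2) $\sum_{i=0}^\infty n_i=n$; (B3) if $i>0$ and $n_i>0$, then $n_1,\ldots,n_{i-1}\ge 2$; (B4) $n_{i-1}+n_i+n_{i+1}+n_{i+2}\ge 2\delta$ for all $i\in\{1,\ldots,r-1\}$ with $i\equiv 1\pmod 4$; (B5) $n_{i-1}+n_i+n_{i+1}+n_{i+2}\ge 4\delta$ for all $i\in\{9,\ldots,r-10\}$ with $i\equiv 1\pmod 4$, then $g(X)\le g(Y_{n,\delta})$.
   Context: For a finite sequence $(n_0,\ldots,n_r)$ we use the convention $n_i=0$ for integers $i<0$ or $i>r$, and $g((n_0,\ldots,n_r))=\sum_{i\ge0} i\,n_i$. For $\delta\ge4$ and $n>15\delta+3$, let $p=\lceil\frac{n-15\delta-3}{4\delta}\rceil$ and $m=n-(4p+8)\delta-4$, and define $Y_{n,\delta}$ to be the sequence $(1,2,2,2\delta-5,\,2,2,2,2\delta-6,\,[2,2,2,4\delta-6]^p,\,2,2,2,2\delta-6,\,2,2,2,2\delta-6,\,2,2,m)$, where $[2,2,2,4\delta-6]^p$ denotes $p$ consecutive repetitions of the block $(2,2,2,4\delta-6)$. -}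

module Defs where

open import Data.Nat using (ℕ; zero; suc; _+_; _*_; _∸_; _/_)
open import Data.List using (List; []; _∷_; _++_; replicate; concat)

-- n_i with the convention n_i = 0 for i > r
-- (indices i < 0 never arise since all indices used are natural numbers)
at : List ℕ → ℕ → ℕ
at []       _       = 0
at (x ∷ xs) zero    = x
at (x ∷ xs) (suc i) = at xs i

gFrom : ℕ → List ℕ → ℕ
gFrom k []       = 0
gFrom k (x ∷ xs) = k * x + gFrom (suc k) xs

g : List ℕ → ℕ
g X = gFrom 0 X

total : List ℕ → ℕ
total []       = 0
total (x ∷ xs) = x + total xs

-- ceiling division ⌈a / b⌉ for b > 0 (value at b = 0 is irrelevant)
ceilDiv : ℕ → ℕ → ℕ
ceilDiv a zero    = 0
ceilDiv a (suc k) = (a + k) / suc k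

pY : ℕ → ℕ → ℕ
pY n δ = ceilDiv (n ∸ (15 * δ + 3)) (4 * δ)

mY : ℕ → ℕ → ℕ
mY n δ = n ∸ ((4 * pY n δ + 8) * δ) ∸ 4

Y : ℕ → ℕ → List ℕ
Y n δ =
  (1 ∷ 2 ∷ 2 ∷ (2 * δ ∸ 5) ∷ 2 ∷ 2 ∷ 2 ∷ (2 * δ ∸ 6) ∷ [])
  ++ concat (replicate (pY n δ) (2 ∷ 2 ∷ 2 ∷ (4 * δ ∸ 6) ∷ []))
  ++ (2 ∷ 2 ∷ 2 ∷ (2 * δ ∸ 6) ∷ 2 ∷ 2 ∷ 2 ∷ (2 * δ ∸ 6) ∷ 2 ∷ 2 ∷ mY n δ ∷ [])

-- Let R be the last index with a nonzero entry and Q(R) = Σ_{i ≤ R} (R − i) n_i. Since the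
-- entries sum to n, g(X) = R·n − Q(R), so it suffices to bound Q(R) below by a quantity L(R)
-- depending only on R and δ, and to show R·n − L(R) ≤ g(Y_{n,δ}) for every R.
-- L(R) is Q(R) for the entrywise smallest admissible sequence 1,2,2,2δ−5,2,2,2,2δ−6,2,2,2,4δ−6,…
-- For R < 8 it is a sum of minimal prefix sums; for larger R, deleting a whole block (block 1,
-- or block 2 once (B5) applies to it) lowers R by 4 and Q by an amount the block constraints
-- control. Along each residue class of R mod 4 the increments L(R + 4) − L(R) grow and cross 4n
-- right after the last index of Y, so R·n − L(R) is largest next to that index, where closed
-- forms for L give the comparison with g(Y) exactly.

module Submission where

open import Data.List using (List; []; _∷_; _++_; length; replicate; concat)
open import Data.Nat using (ℕ; zero; suc; _+_; _*_; _∸_; _≤_; _<_; _>_; _%_; _/_; z≤n; s≤s; _≤?_)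
open import Data.Nat.DivMod using (m≡m%n+[m/n]*n; m%n<n; [m+kn]%n≡m%n)
open import Data.Nat.Properties
open import Algebra.Properties.CommutativeSemigroup +-commutativeSemigroup
  using (interchange; x∙yz≈y∙xz; xy∙z≈xz∙y)
open import Data.Nat.Tactic.RingSolver using (solve-∀)
open import Data.Product using (_×_; _,_; proj₁; proj₂)
open import Data.Sum using (_⊎_; inj₁; inj₂)
open import Data.Empty using (⊥-elim)
open import Relation.Nullary using (yes; no)
open import Relation.Binary.PropositionalEquality

open import Defs

∸-cancel : ∀ k {x y} → y ≡ k + x → y ∸ k ≡ x
∸-cancel k {x} y≡k+x = trans (cong (_∸ k) y≡k+x) (m+n∸m≡n k x)

≤-by-surplus : ∀ {a b} s → b ≡ a + s → a ≤ b
≤-by-surplus s b≡a+s = ≤-trans (m≤m+n _ s) (≤-reflexive (sym b≡a+s))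

≤-by-trade : ∀ {a b x y} s → b + x ≡ a + (y + s) → x ≤ y → a ≤ b
≤-by-trade {a} {b} {x} {y} s b+x≡ x≤y = +-cancelʳ-≤ y a b (begin
  a + y        ≤⟨ m≤m+n (a + y) s ⟩
  a + y + s    ≡⟨ trans (+-assoc a y s) (sym b+x≡) ⟩
  b + x        ≤⟨ +-monoʳ-≤ b x≤y ⟩
  b + y        ∎)
  where open ≤-Reasoning

-- Finite sums

sumBelow : (ℕ → ℕ) → ℕ → ℕ
sumBelow f zero    = 0
sumBelow f (suc N) = sumBelow f N + f N

sumBelow-cong : ∀ {f h : ℕ → ℕ} N → (∀ i → i < N → f i ≡ h i) → sumBelow f N ≡ sumBelow h N
sumBelow-cong zero    f≡h = refl
sumBelow-cong (suc N) f≡h =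
  cong₂ _+_ (sumBelow-cong N (λ i i<N → f≡h i (m<n⇒m<1+n i<N))) (f≡h N ≤-refl)

sumBelow-mono : ∀ {f h : ℕ → ℕ} N → (∀ i → i < N → f i ≤ h i) → sumBelow f N ≤ sumBelow h N
sumBelow-mono zero    f≤h = z≤n
sumBelow-mono (suc N) f≤h =
  +-mono-≤ (sumBelow-mono N (λ i i<N → f≤h i (m<n⇒m<1+n i<N))) (f≤h N ≤-refl)

sumBelow-+ : ∀ f h N → sumBelow (λ i → f i + h i) N ≡ sumBelow f N + sumBelow h N
sumBelow-+ f h zero    = refl
sumBelow-+ f h (suc N) rewrite sumBelow-+ f h N = interchange (sumBelow f N) (sumBelow h N) (f N) (h N)

sumBelow-*ˡ : ∀ c f N → sumBelow (λ i → c * f i) N ≡ c * sumBelow f N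
sumBelow-*ˡ c f zero    = sym (*-zeroʳ c)
sumBelow-*ˡ c f (suc N) rewrite sumBelow-*ˡ c f N = sym (*-distribˡ-+ c (sumBelow f N) (f N))

sumBelow-split : ∀ f a b → sumBelow f (a + b) ≡ sumBelow f a + sumBelow (λ k → f (a + k)) b
sumBelow-split f a zero    rewrite +-identityʳ a = sym (+-identityʳ _)
sumBelow-split f a (suc b) rewrite +-suc a b | sumBelow-split f a b =
  +-assoc (sumBelow f a) _ (f (a + b))

sumBelow-≤-+ : ∀ f a b → sumBelow f a ≤ sumBelow f (a + b)
sumBelow-≤-+ f a b = ≤-by-surplus _ (sumBelow-split f a b)

sumBelow-vanishing : ∀ f {a N} → a ≤ N → (∀ i → a ≤ i → f i ≡ 0) → sumBelow f N ≡ sumBelow f a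
sumBelow-vanishing f {a} {N} a≤N vanish = begin
  sumBelow f N                                          ≡⟨ cong (sumBelow f) (sym (m+[n∸m]≡n a≤N)) ⟩
  sumBelow f (a + (N ∸ a))                              ≡⟨ sumBelow-split f a (N ∸ a) ⟩
  sumBelow f a + sumBelow (λ k → f (a + k)) (N ∸ a)    ≡⟨ cong (sumBelow f a +_) tail≡0 ⟩
  sumBelow f a + 0                                      ≡⟨ +-identityʳ _ ⟩
  sumBelow f a                                          ∎
  where
    open ≡-Reasoning
    tail≡0 : sumBelow (λ k → f (a + k)) (N ∸ a) ≡ 0
    tail≡0 = trans (sumBelow-cong (N ∸ a) (λ k _ → vanish (a + k) (m≤m+n a k))) (sumBelow-*ˡ 0 f (N ∸ a))

at-≥length : ∀ X i → length X ≤ i → at X i ≡ 0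
at-≥length []      i       _          = refl
at-≥length (x ∷ X) (suc i) (s≤s X≤i) = at-≥length X i X≤i

gFrom≡sumBelow : ∀ k X → gFrom k X ≡ sumBelow (λ i → (k + i) * at X i) (length X)
gFrom≡sumBelow k []      = refl
gFrom≡sumBelow k (x ∷ X) = begin
  k * x + gFrom (suc k) X
    ≡⟨ cong₂ _+_ (cong (_* x) (sym (+-identityʳ k))) (gFrom≡sumBelow (suc k) X) ⟩
  (k + 0) * x + sumBelow (λ i → (suc k + i) * at X i) (length X)
    ≡⟨ cong ((k + 0) * x +_) (sumBelow-cong (length X) (λ i _ → cong (_* at X i) (sym (+-suc k i)))) ⟩
  (k + 0) * x + sumBelow (λ i → (k + suc i) * at X i) (length X)
    ≡⟨ sym (sumBelow-split (λ i → (k + i) * at (x ∷ X) i) 1 (length X)) ⟩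
  sumBelow (λ i → (k + i) * at (x ∷ X) i) (length (x ∷ X)) ∎
  where open ≡-Reasoning

total≡sumBelow : ∀ X → total X ≡ sumBelow (at X) (length X)
total≡sumBelow []      = refl
total≡sumBelow (x ∷ X) = trans (cong (x +_) (total≡sumBelow X)) (sym (sumBelow-split (at (x ∷ X)) 1 (length X)))

gFrom-++ : ∀ k xs ys → gFrom k (xs ++ ys) ≡ gFrom k xs + gFrom (k + length xs) ys
gFrom-++ k []       ys rewrite +-identityʳ k = refl
gFrom-++ k (x ∷ xs) ys rewrite gFrom-++ (suc k) xs ys | +-suc k (length xs) =
  sym (+-assoc (k * x) _ _)

-- The extremal sequence Y

Yhead : ℕ → ℕ → List ℕ
Yhead a b = 1 ∷ 2 ∷ 2 ∷ a ∷ 2 ∷ 2 ∷ 2 ∷ b ∷ []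

Yblocks : ℕ → ℕ → List ℕ
Yblocks c p = concat (replicate p (2 ∷ 2 ∷ 2 ∷ c ∷ []))

Ytail : ℕ → ℕ → List ℕ
Ytail b m = 2 ∷ 2 ∷ 2 ∷ b ∷ 2 ∷ 2 ∷ 2 ∷ b ∷ 2 ∷ 2 ∷ m ∷ []

Ytotal : ℕ → ℕ → ℕ → ℕ
Ytotal δ p m = 4 * δ * (p + 2) + 4 + m

gYformula : ℕ → ℕ → ℕ → ℕ
gYformula δ p m = 8 * δ * (p + 2) * (p + 2) + 20 * δ * (p + 2) + (4 * (p + 2) + 10) * m + 4 * (p + 2) + 13

length-Yblocks : ∀ c p → length (Yblocks c p) ≡ p * 4
length-Yblocks c zero    = refl
length-Yblocks c (suc p) = cong (4 +_) (length-Yblocks c p)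

gFrom-Yblocks : ∀ e k p → gFrom k (Yblocks (6 + e) p) ≡ (12 + e) * (k * p + 2 * p * p) + e * p
gFrom-Yblocks e k zero    = no-blocks e k
  where
    no-blocks : ∀ e k → 0 ≡ (12 + e) * (k * 0 + 2 * 0 * 0) + e * 0
    no-blocks = solve-∀
gFrom-Yblocks e k (suc p) = trans
  (cong (λ x → k * 2 + ((1 + k) * 2 + ((2 + k) * 2 + ((3 + k) * (6 + e) + x)))) (gFrom-Yblocks e (4 + k) p))
  (add-block e k p)
  where
    add-block : ∀ e k p →
      k * 2 + ((1 + k) * 2 + ((2 + k) * 2 + ((3 + k) * (6 + e) + ((12 + e) * ((4 + k) * p + 2 * p * p) + e * p))))
        ≡ (12 + e) * (k * (1 + p) + 2 * (1 + p) * (1 + p)) + e * (1 + p)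
    add-block = solve-∀

gY-shape : ∀ d p m → g (Yhead (1 + 2 * d) (2 * d) ++ Yblocks (6 + 4 * d) p ++ Ytail (2 * d) m)
                   ≡ gYformula (3 + d) p m
gY-shape d p m = begin
  gFrom 0 (Yhead a b ++ Yblocks c p ++ Ytail b m)
    ≡⟨ gFrom-++ 0 (Yhead a b) (Yblocks c p ++ Ytail b m) ⟩
  gFrom 0 (Yhead a b) + gFrom 8 (Yblocks c p ++ Ytail b m)
    ≡⟨ cong (gFrom 0 (Yhead a b) +_) (gFrom-++ 8 (Yblocks c p) (Ytail b m)) ⟩
  gFrom 0 (Yhead a b) + (gFrom 8 (Yblocks c p) + gFrom (8 + length (Yblocks c p)) (Ytail b m))
    ≡⟨ cong (λ l → gFrom 0 (Yhead a b) + (gFrom 8 (Yblocks c p) + gFrom l (Ytail b m))) (cong (8 +_) (length-Yblocks c p)) ⟩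
  gFrom 0 (Yhead a b) + (gFrom 8 (Yblocks c p) + gFrom (8 + p * 4) (Ytail b m))
    ≡⟨ cong (λ x → gFrom 0 (Yhead a b) + (x + gFrom (8 + p * 4) (Ytail b m))) (gFrom-Yblocks (4 * d) 8 p) ⟩
  _
    ≡⟨ assemble d p m ⟩
  gYformula (3 + d) p m ∎
  where
    open ≡-Reasoning
    a b c : ℕ
    a = 1 + 2 * d
    b = 2 * d
    c = 6 + 4 * d
    assemble : ∀ d p m →
      0 * 1 + (1 * 2 + (2 * 2 + (3 * (1 + 2 * d) + (4 * 2 + (5 * 2 + (6 * 2 + (7 * (2 * d) + 0)))))))
      + ((12 + 4 * d) * (8 * p + 2 * p * p) + 4 * d * p
         + ((8 + p * 4) * 2 + ((9 + p * 4) * 2 + ((10 + p * 4) * 2 + ((11 + p * 4) * (2 * d) + ((12 + p * 4) * 2 + ((13 + p * 4) * 2 + ((14 + p * 4) * 2 + ((15 + p * 4) * (2 * d) + ((16 + p * 4) * 2 + ((17 + p * 4) * 2 + ((18 + p * 4) * m + 0))))))))))))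
        ≡ 8 * (3 + d) * (p + 2) * (p + 2) + 20 * (3 + d) * (p + 2) + (4 * (p + 2) + 10) * m + 4 * (p + 2) + 13
    assemble = solve-∀

g-Y : ∀ n d → g (Y n (3 + d)) ≡ gYformula (3 + d) (pY n (3 + d)) (mY n (3 + d))
g-Y n d = shape-at (∸-cancel 5 (2δ≡5+a d)) (∸-cancel 6 (2δ≡6+b d)) (∸-cancel 6 (4δ≡6+c d))
  where
    p m : ℕ
    p = pY n (3 + d)
    m = mY n (3 + d)
    shape-at : ∀ {a b c} → a ≡ 1 + 2 * d → b ≡ 2 * d → c ≡ 6 + 4 * d →
               g (Yhead a b ++ Yblocks c p ++ Ytail b m) ≡ gYformula (3 + d) p m
    shape-at refl refl refl = gY-shape d p m
    2δ≡5+a : ∀ d → 2 * (3 + d) ≡ 5 + (1 + 2 * d)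
    2δ≡5+a = solve-∀
    2δ≡6+b : ∀ d → 2 * (3 + d) ≡ 6 + 2 * d
    2δ≡6+b = solve-∀
    4δ≡6+c : ∀ d → 4 * (3 + d) ≡ 6 + (6 + 4 * d)
    4δ≡6+c = solve-∀

ceilDiv-bounds : ∀ a k → a ≤ ceilDiv a (suc k) * suc k × ceilDiv a (suc k) * suc k ≤ a + k
ceilDiv-bounds a k = a≤qb , qb≤a+k
  where
    open ≤-Reasoning
    q r : ℕ
    q = (a + k) / suc k
    r = (a + k) % suc k
    a+k≡ : a + k ≡ r + q * suc k
    a+k≡ = m≡m%n+[m/n]*n (a + k) (suc k)
    a≤qb : a ≤ q * suc k
    a≤qb = +-cancelʳ-≤ k a (q * suc k) (begin
      a + k          ≡⟨ a+k≡ ⟩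
      r + q * suc k  ≤⟨ +-monoˡ-≤ (q * suc k) (≤-pred (m%n<n (a + k) (suc k))) ⟩
      k + q * suc k  ≡⟨ +-comm k _ ⟩
      q * suc k + k  ∎)
    qb≤a+k : q * suc k ≤ a + k
    qb≤a+k = ≤-trans (m≤n+m (q * suc k) r) (≤-reflexive (sym a+k≡))

record YParameters (n δ : ℕ) : Set where
  field
    n≡Ytotal : n ≡ Ytotal δ (pY n δ) (mY n δ)
    3δ≤m     : 3 * δ ≤ mY n δ
    m<7δ     : mY n δ < 7 * δ

-- With A = n − 15δ − 3, the ceiling p = ⌈A / 4δ⌉ satisfies A ≤ 4δp ≤ A + 4δ − 1,
-- so m = 3δ + w where w = A + 4δ − 1 − 4δp < 4δ.
yParameters : ∀ n d → 15 * suc d + 3 < n → YParameters n (suc d)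
yParameters n d n> = record
  { n≡Ytotal = trans n≡U+4+m (Ytotal-expand d p (mY n δ))
  ; 3δ≤m     = subst (3 * δ ≤_) (sym m≡) (m≤m+n (3 * δ) w)
  ; m<7δ     = subst (_< 7 * δ) (sym m≡) (begin
      suc (3 * δ + w)  ≡⟨ sym (+-suc (3 * δ) w) ⟩
      3 * δ + suc w    ≤⟨ +-monoʳ-≤ (3 * δ) (s≤s w≤k) ⟩
      3 * δ + suc k    ≡⟨ 3δ+4δ d ⟩
      7 * δ            ∎)
  }
  where
    open ≤-Reasoning
    regroup : ∀ d A → 15 * (1 + d) + 3 + A + (1 + (d + 3 * (1 + d))) ≡ 15 * (1 + d) + 4 + (A + (d + 3 * (1 + d)))
    regroup = solve-∀
    expand : ∀ d p w → 15 * (1 + d) + 4 + (p * (1 + (d + 3 * (1 + d))) + w)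
                    ≡ (4 * p + 8) * (1 + d) + (4 + (3 * (1 + d) + w)) + (1 + (d + 3 * (1 + d)))
    expand = solve-∀
    3δ+4δ : ∀ d → 3 * (1 + d) + (1 + (d + 3 * (1 + d))) ≡ 7 * (1 + d)
    3δ+4δ = solve-∀
    δ k A p U w : ℕ
    δ = suc d
    k = d + 3 * suc d
    A = n ∸ (15 * δ + 3)
    p = pY n δ
    U = (4 * p + 8) * δ
    bounds : A ≤ p * suc k × p * suc k ≤ A + k
    bounds = ceilDiv-bounds A k
    w = proj₁ (m≤n⇒∃[o]m+o≡n (proj₂ bounds))
    T+w≡A+k : p * suc k + w ≡ A + k
    T+w≡A+k = proj₂ (m≤n⇒∃[o]m+o≡n (proj₂ bounds))
    w≤k : w ≤ k
    w≤k = +-cancelˡ-≤ (p * suc k) w k (≤-trans (≤-reflexive T+w≡A+k) (+-monoˡ-≤ k (proj₁ bounds)))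
    n≡U+rest : n ≡ U + (4 + (3 * δ + w))
    n≡U+rest = +-cancelʳ-≡ (suc k) n _ (begin-equality
      n + suc k                     ≡⟨ cong (_+ suc k) (sym (m+[n∸m]≡n (<⇒≤ n>))) ⟩
      15 * δ + 3 + A + suc k        ≡⟨ regroup d A ⟩
      15 * δ + 4 + (A + k)          ≡⟨ cong (15 * δ + 4 +_) (sym T+w≡A+k) ⟩
      15 * δ + 4 + (p * suc k + w)  ≡⟨ expand d p w ⟩
      U + (4 + (3 * δ + w)) + suc k ∎)
    m≡ : mY n δ ≡ 3 * δ + w
    m≡ = ∸-cancel 4 (∸-cancel U n≡U+rest)
    n≡U+4+m : n ≡ U + (4 + mY n δ)
    n≡U+4+m = trans n≡U+rest (cong (λ x → U + (4 + x)) (sym m≡))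
    Ytotal-expand : ∀ d p m → (4 * p + 8) * (1 + d) + (4 + m) ≡ 4 * (1 + d) * (p + 2) + 4 + m
    Ytotal-expand = solve-∀

-- Reverse moments and admissible sequences

revMoment : (ℕ → ℕ) → ℕ → ℕ
revMoment f r = sumBelow (λ i → (r ∸ i) * f i) (suc r)

revMoment+moment : ∀ f r → revMoment f r + sumBelow (λ i → i * f i) (suc r) ≡ r * sumBelow f (suc r)
revMoment+moment f r = begin
  revMoment f r + sumBelow (λ i → i * f i) (suc r)
    ≡⟨ sym (sumBelow-+ (λ i → (r ∸ i) * f i) (λ i → i * f i) (suc r)) ⟩
  sumBelow (λ i → (r ∸ i) * f i + i * f i) (suc r)
    ≡⟨ sumBelow-cong (suc r) (λ i i≤r →
         trans (sym (*-distribʳ-+ (f i) (r ∸ i) i)) (cong (_* f i) (m∸n+n≡m (≤-pred i≤r)))) ⟩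
  sumBelow (λ i → r * f i) (suc r)
    ≡⟨ sumBelow-*ˡ r f (suc r) ⟩
  r * sumBelow f (suc r) ∎
  where open ≡-Reasoning

g+revMoment : ∀ X R → R < length X → (∀ i → R < i → at X i ≡ 0) → g X + revMoment (at X) R ≡ R * total X
g+revMoment X R R<len vanish = begin
  g X + revMoment (at X) R
    ≡⟨ +-comm (g X) _ ⟩
  revMoment (at X) R + gFrom 0 X
    ≡⟨ cong (revMoment (at X) R +_) (trans (gFrom≡sumBelow 0 X) (sumBelow-vanishing _ R<len moment-vanish)) ⟩
  revMoment (at X) R + sumBelow (λ i → i * at X i) (suc R)
    ≡⟨ revMoment+moment (at X) R ⟩
  R * sumBelow (at X) (suc R)
    ≡⟨ cong (R *_) (sym (trans (total≡sumBelow X) (sumBelow-vanishing (at X) R<len vanish))) ⟩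
  R * total X ∎
  where
    open ≡-Reasoning
    moment-vanish : ∀ i → suc R ≤ i → i * at X i ≡ 0
    moment-vanish i R<i = trans (cong (i *_) (vanish i R<i)) (*-zeroʳ i)

revMoment-suc : ∀ f r → revMoment f (suc r) ≡ revMoment f r + sumBelow f (suc r)
revMoment-suc f r = begin
  sumBelow (λ i → (suc r ∸ i) * f i) (suc r) + (r ∸ r) * f (suc r)
    ≡⟨ cong₂ _+_ (sumBelow-cong (suc r) (λ i i≤r → cong (_* f i) (+-∸-assoc 1 (≤-pred i≤r))))
                 (cong (_* f (suc r)) (n∸n≡0 r)) ⟩
  sumBelow (λ i → f i + (r ∸ i) * f i) (suc r) + 0
    ≡⟨ +-identityʳ _ ⟩
  sumBelow (λ i → f i + (r ∸ i) * f i) (suc r)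
    ≡⟨ sumBelow-+ f (λ i → (r ∸ i) * f i) (suc r) ⟩
  sumBelow f (suc r) + revMoment f r
    ≡⟨ +-comm _ (revMoment f r) ⟩
  revMoment f r + sumBelow f (suc r) ∎
  where open ≡-Reasoning

revMoment≡sumBelow-prefixes : ∀ f r → revMoment f r ≡ sumBelow (λ k → sumBelow f (suc k)) r
revMoment≡sumBelow-prefixes f zero    = refl
revMoment≡sumBelow-prefixes f (suc r) =
  trans (revMoment-suc f r) (cong (_+ sumBelow f (suc r)) (revMoment≡sumBelow-prefixes f r))

skip4 : ℕ → ℕ → ℕ
skip4 zero    i       = 4 + i
skip4 (suc c) zero    = zero
skip4 (suc c) (suc i) = suc (skip4 c i)

skip4-< : ∀ c i → i < c → skip4 c i ≡ i
skip4-< (suc c) zero    _         = refl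
skip4-< (suc c) (suc i) (s≤s i<c) = cong suc (skip4-< c i i<c)

skip4-≥ : ∀ c i → c ≤ i → skip4 c i ≡ 4 + i
skip4-≥ zero    i       _         = refl
skip4-≥ (suc c) (suc i) (s≤s c≤i) = cong suc (skip4-≥ c i c≤i)

i≤skip4 : ∀ c i → i ≤ skip4 c i
i≤skip4 zero    i       = m≤n+m i 4
i≤skip4 (suc c) zero    = z≤n
i≤skip4 (suc c) (suc i) = s≤s (i≤skip4 c i)

skip4≤4+i : ∀ c i → skip4 c i ≤ 4 + i
skip4≤4+i zero    i       = ≤-refl
skip4≤4+i (suc c) zero    = z≤n
skip4≤4+i (suc c) (suc i) = s≤s (skip4≤4+i c i)

-- Deleting the entries c, …, c + 3 brings every earlier entry 4 steps closer to the end.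
revMoment-skip4 : ∀ f c r e → c + e ≡ suc r →
  revMoment f (4 + r) ≡ revMoment (λ i → f (skip4 c i)) r
                        + (4 * sumBelow f c + sumBelow (λ t → (4 + r ∸ (c + t)) * f (c + t)) 4)
revMoment-skip4 f c r e c+e≡1+r = begin
  sumBelow H (5 + r)
    ≡⟨ cong (sumBelow H) (sym (trans (x∙yz≈y∙xz c 4 e) (cong (4 +_) c+e≡1+r))) ⟩
  sumBelow H (c + (4 + e))
    ≡⟨ sumBelow-split H c (4 + e) ⟩
  sumBelow H c + sumBelow (λ k → H (c + k)) (4 + e)
    ≡⟨ cong (sumBelow H c +_) (sumBelow-split (λ k → H (c + k)) 4 e) ⟩
  sumBelow H c + (removed + sumBelow (λ k → H (c + (4 + k))) e)
    ≡⟨ cong₂ (λ u v → u + (removed + v)) before after ⟩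
  (sumBelow H′ c + 4 * sumBelow f c) + (removed + sumBelow (λ k → H′ (c + k)) e)
    ≡⟨ rearrange (sumBelow H′ c) (4 * sumBelow f c) removed _ ⟩
  (sumBelow H′ c + sumBelow (λ k → H′ (c + k)) e) + (4 * sumBelow f c + removed)
    ≡⟨ cong (_+ (4 * sumBelow f c + removed)) (sym (trans (cong (sumBelow H′) (sym c+e≡1+r)) (sumBelow-split H′ c e))) ⟩
  revMoment (λ i → f (skip4 c i)) r + (4 * sumBelow f c + removed) ∎
  where
    open ≡-Reasoning
    H H′ : ℕ → ℕ
    H  i = (4 + r ∸ i) * f i
    H′ i = (r ∸ i) * f (skip4 c i)
    removed : ℕ
    removed = sumBelow (λ t → (4 + r ∸ (c + t)) * f (c + t)) 4
    c≤1+r : c ≤ suc r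
    c≤1+r = subst (c ≤_) c+e≡1+r (m≤m+n c e)
    before : sumBelow H c ≡ sumBelow H′ c + 4 * sumBelow f c
    before = trans
      (sumBelow-cong c (λ i i<c → begin
        (4 + r ∸ i) * f i            ≡⟨ cong (_* f i) (+-∸-assoc 4 (≤-pred (≤-trans i<c c≤1+r))) ⟩
        (4 + (r ∸ i)) * f i          ≡⟨ *-distribʳ-+ (f i) 4 (r ∸ i) ⟩
        4 * f i + (r ∸ i) * f i      ≡⟨ +-comm (4 * f i) _ ⟩
        (r ∸ i) * f i + 4 * f i      ≡⟨ cong (λ j → (r ∸ i) * f j + 4 * f i) (sym (skip4-< c i i<c)) ⟩
        H′ i + 4 * f i               ∎))
      (trans (sumBelow-+ H′ (λ i → 4 * f i) c) (cong (sumBelow H′ c +_) (sumBelow-*ˡ 4 f c)))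
    after : sumBelow (λ k → H (c + (4 + k))) e ≡ sumBelow (λ k → H′ (c + k)) e
    after = sumBelow-cong e (λ k _ → trans
      (cong (λ j → (4 + r ∸ j) * f j) (x∙yz≈y∙xz c 4 k))
      (cong (λ j → (r ∸ (c + k)) * f j) (sym (skip4-≥ c (c + k) (m≤m+n c k)))))
    rearrange : ∀ a b x y → (a + b) + (x + y) ≡ (a + y) + (b + x)
    rearrange = solve-∀

blockSum : (ℕ → ℕ) → ℕ → ℕ
blockSum f j = f (j * 4) + f (1 + j * 4) + f (2 + j * 4) + f (3 + j * 4)

-- The constraints (B1)–(B5) on the entries up to the last nonzero index R;
-- blockSum f j is the window of (B4) and (B5) at i = 4j + 1.
record Admissible (δ : ℕ) (f : ℕ → ℕ) (R : ℕ) : Set where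
  field
    head≡1   : f 0 ≡ 1
    inner≥2  : ∀ j → 1 ≤ j → j < R → 2 ≤ f j
    block≥2δ : ∀ j → 2 + j * 4 ≤ R → 2 * δ ≤ blockSum f j
    block≥4δ : ∀ j → 11 + (2 + j) * 4 ≤ R → 4 * δ ≤ blockSum f (2 + j)

open Admissible

minPrefix : ℕ → ℕ → ℕ
minPrefix δ 0 = 0
minPrefix δ 1 = 1
minPrefix δ 2 = 3
minPrefix δ 3 = 5
minPrefix δ 4 = 2 * δ
minPrefix δ (suc (suc (suc (suc (suc k))))) = minPrefix δ (suc (suc (suc (suc k)))) + 2

minPrefix≤sumBelow : ∀ {δ f R} → Admissible δ f R → ∀ k → k ≤ R → minPrefix δ k ≤ sumBelow f k
minPrefix≤sumBelow A 0 _   = z≤n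
minPrefix≤sumBelow A 1 _   = ≤-reflexive (sym (head≡1 A))
minPrefix≤sumBelow A 2 2≤R = +-mono-≤ (minPrefix≤sumBelow A 1 (<⇒≤ 2≤R)) (inner≥2 A 1 ≤-refl 2≤R)
minPrefix≤sumBelow A 3 3≤R = +-mono-≤ (minPrefix≤sumBelow A 2 (<⇒≤ 3≤R)) (inner≥2 A 2 (s≤s z≤n) 3≤R)
minPrefix≤sumBelow A 4 4≤R = block≥2δ A 0 (≤-trans (m≤m+n 2 2) 4≤R)
minPrefix≤sumBelow A (suc (suc (suc (suc (suc k))))) k<R =
  +-mono-≤ (minPrefix≤sumBelow A (suc (suc (suc (suc k)))) (<⇒≤ k<R)) (inner≥2 A (4 + k) (s≤s z≤n) k<R)

-- minRevMoment δ R is the reverse moment of the smallest admissible sequence. Beyond R = 7 it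
-- grows by the contribution of the block deleted in remove-block: block 1 while R < 19,
-- afterwards block 2, the first block on which (B5) is in force.
step : ℕ → ℕ → ℕ
step δ (suc (suc (suc (suc (suc (suc (suc (suc (suc (suc (suc k))))))))))) = 4 * δ * (12 + k) + 12
step δ r = 2 * δ * (r + 5) + 12

minRevMoment : ℕ → ℕ → ℕ
minRevMoment δ (suc (suc (suc (suc (suc (suc (suc (suc r)))))))) = minRevMoment δ (suc (suc (suc (suc r)))) + step δ r
minRevMoment δ R = sumBelow (λ k → minPrefix δ (suc k)) R

-- step δ r only unfolds for concrete r; this view exposes its value in both phases.
data StepPhase (δ : ℕ) : ℕ → Set where
  early : ∀ {r} → r ≤ 10 → step δ r ≡ 2 * δ * (r + 5) + 12 → StepPhase δ r
  late  : ∀ k → StepPhase δ (11 + k)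

stepPhase : ∀ δ r → StepPhase δ r
stepPhase δ (suc (suc (suc (suc (suc (suc (suc (suc (suc (suc (suc k))))))))))) = late k
stepPhase δ 0  = early z≤n refl
stepPhase δ 1  = early (s≤s z≤n) refl
stepPhase δ 2  = early (s≤s (s≤s z≤n)) refl
stepPhase δ 3  = early (m≤m+n 3 7) refl
stepPhase δ 4  = early (m≤m+n 4 6) refl
stepPhase δ 5  = early (m≤m+n 5 5) refl
stepPhase δ 6  = early (m≤m+n 6 4) refl
stepPhase δ 7  = early (m≤m+n 7 3) refl
stepPhase δ 8  = early (m≤m+n 8 2) refl
stepPhase δ 9  = early (m≤m+n 9 1) refl
stepPhase δ 10 = early ≤-refl refl

weighted-twos : ∀ {a b c} → 2 ≤ a → 2 ≤ b → 2 ≤ c → 12 ≤ 3 * a + 2 * b + c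
weighted-twos 2≤a 2≤b 2≤c = +-mono-≤ (+-mono-≤ (*-monoʳ-≤ 3 2≤a) (*-monoʳ-≤ 2 2≤b)) 2≤c

removed-block-bound : ∀ {g : ℕ → ℕ} {B} s → B ≤ sumBelow g 4 → 2 ≤ g 0 → 2 ≤ g 1 → 2 ≤ g 2 →
                      (1 + s) * B + 12 ≤ sumBelow (λ t → (4 + s ∸ t) * g t) 4
removed-block-bound {g} {B} s B≤ 2≤g₀ 2≤g₁ 2≤g₂ = begin
  (1 + s) * B + 12
    ≤⟨ +-mono-≤ (*-monoʳ-≤ (1 + s) B≤) (weighted-twos 2≤g₀ 2≤g₁ 2≤g₂) ⟩
  (1 + s) * (g 0 + g 1 + g 2 + g 3) + (3 * g 0 + 2 * g 1 + g 2)
    ≡⟨ by-weights s (g 0) (g 1) (g 2) (g 3) ⟩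
  (4 + s) * g 0 + (3 + s) * g 1 + (2 + s) * g 2 + (1 + s) * g 3 ∎
  where
    open ≤-Reasoning
    by-weights : ∀ s a b c d → (1 + s) * (a + b + c + d) + (3 * a + 2 * b + c)
                             ≡ (4 + s) * a + (3 + s) * b + (2 + s) * c + (1 + s) * d
    by-weights = solve-∀

skip4-inner≥2 : ∀ {f : ℕ → ℕ} {R} c → (∀ j → 1 ≤ j → j < 4 + R → 2 ≤ f j) →
                ∀ j → 1 ≤ j → j < R → 2 ≤ f (skip4 c j)
skip4-inner≥2 c inner j 1≤j j<R =
  inner (skip4 c j) (≤-trans 1≤j (i≤skip4 c j)) (≤-trans (s≤s (skip4≤4+i c j)) (+-monoʳ-≤ 4 j<R))

skip-block₁ : ∀ {δ f R} → Admissible δ f (4 + R) → Admissible δ (λ i → f (skip4 4 i)) R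
skip-block₁ {f = f} {R = R} A = record
  { head≡1   = head≡1 A
  ; inner≥2  = skip4-inner≥2 {f = f} 4 (inner≥2 A)
  ; block≥2δ = λ { zero    h → block≥2δ A 0 (≤-trans h (m≤n+m R 4))
                 ; (suc j) h → block≥2δ A (2 + j) (+-monoʳ-≤ 4 h) }
  ; block≥4δ = λ j h → block≥4δ A (suc j) (+-monoʳ-≤ 4 h)
  }

skip-block₂ : ∀ {δ f R} → Admissible δ f (4 + R) → Admissible δ (λ i → f (skip4 8 i)) R
skip-block₂ {f = f} {R = R} A = record
  { head≡1   = head≡1 A
  ; inner≥2  = skip4-inner≥2 {f = f} 8 (inner≥2 A)
  ; block≥2δ = λ { zero          h → block≥2δ A 0 (≤-trans h (m≤n+m R 4))
                 ; (suc zero)    h → block≥2δ A 1 (≤-trans h (m≤n+m R 4))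
                 ; (suc (suc j)) h → block≥2δ A (3 + j) (+-monoʳ-≤ 4 h) }
  ; block≥4δ = λ j h → block≥4δ A (suc j) (+-monoʳ-≤ 4 h)
  }

block₁-excess : ∀ {δ f r} → Admissible δ f (8 + r) →
  2 * δ * (r + 5) + 12 ≤ 4 * sumBelow f 4 + sumBelow (λ t → (4 + (4 + r) ∸ (4 + t)) * f (4 + t)) 4
block₁-excess {δ} {f} {r} A = begin
  2 * δ * (r + 5) + 12
    ≡⟨ regroup δ r ⟩
  4 * (2 * δ) + ((1 + r) * (2 * δ) + 12)
    ≤⟨ +-mono-≤ (*-monoʳ-≤ 4 (block≥2δ A 0 (m≤m+n 2 (6 + r))))
                (removed-block-bound {g = λ t → f (4 + t)} r (block≥2δ A 1 (m≤m+n 6 (2 + r)))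
                   (inner≥2 A 4 (s≤s z≤n) (m≤m+n 5 (3 + r)))
                   (inner≥2 A 5 (s≤s z≤n) (m≤m+n 6 (2 + r)))
                   (inner≥2 A 6 (s≤s z≤n) (m≤m+n 7 (1 + r)))) ⟩
  4 * sumBelow f 4 + sumBelow (λ t → (4 + (4 + r) ∸ (4 + t)) * f (4 + t)) 4 ∎
  where
    open ≤-Reasoning
    regroup : ∀ δ r → 2 * δ * (r + 5) + 12 ≡ 4 * (2 * δ) + ((1 + r) * (2 * δ) + 12)
    regroup = solve-∀

block₂-excess : ∀ {δ f k} → Admissible δ f (19 + k) →
  4 * δ * (12 + k) + 12 ≤ 4 * sumBelow f 8 + sumBelow (λ t → (4 + (15 + k) ∸ (8 + t)) * f (8 + t)) 4
block₂-excess {δ} {f} {k} A = begin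
  4 * δ * (12 + k) + 12
    ≡⟨ regroup δ k ⟩
  4 * (2 * δ + 2 * δ) + ((1 + (7 + k)) * (4 * δ) + 12)
    ≤⟨ +-mono-≤ (*-monoʳ-≤ 4 first-blocks)
                (removed-block-bound {g = λ t → f (8 + t)} (7 + k) (block≥4δ A 0 (m≤m+n 19 k))
                   (inner≥2 A 8 (s≤s z≤n) (m≤m+n 9 (10 + k)))
                   (inner≥2 A 9 (s≤s z≤n) (m≤m+n 10 (9 + k)))
                   (inner≥2 A 10 (s≤s z≤n) (m≤m+n 11 (8 + k)))) ⟩
  4 * sumBelow f 8 + sumBelow (λ t → (4 + (15 + k) ∸ (8 + t)) * f (8 + t)) 4 ∎
  where
    open ≤-Reasoning
    regroup : ∀ δ k → 4 * δ * (12 + k) + 12 ≡ 4 * (2 * δ + 2 * δ) + ((1 + (7 + k)) * (4 * δ) + 12)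
    regroup = solve-∀
    first-blocks : 2 * δ + 2 * δ ≤ sumBelow f 8
    first-blocks = ≤-trans (+-mono-≤ (block≥2δ A 0 (m≤m+n 2 (17 + k))) (block≥2δ A 1 (m≤m+n 6 (13 + k))))
                           (≤-reflexive (sym (sumBelow-split f 4 4)))

prefix-sums-bound : ∀ {δ f R} → Admissible δ f R → sumBelow (λ k → minPrefix δ (suc k)) R ≤ revMoment f R
prefix-sums-bound {δ} {f} {R} A = begin
  sumBelow (λ k → minPrefix δ (suc k)) R  ≤⟨ sumBelow-mono R (λ k k<R → minPrefix≤sumBelow A (suc k) k<R) ⟩
  sumBelow (λ k → sumBelow f (suc k)) R   ≡⟨ sym (revMoment≡sumBelow-prefixes f R) ⟩
  revMoment f R                           ∎
  where open ≤-Reasoning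

remove-block : ∀ {δ f} r → StepPhase δ r → Admissible δ f (8 + r) →
  (∀ {h} → Admissible δ h (4 + r) → minRevMoment δ (4 + r) ≤ revMoment h (4 + r)) →
  minRevMoment δ (8 + r) ≤ revMoment f (8 + r)
remove-block {δ} {f} r (early _ step≡) A IH = begin
  minRevMoment δ (4 + r) + step δ r
    ≡⟨ cong (minRevMoment δ (4 + r) +_) step≡ ⟩
  minRevMoment δ (4 + r) + (2 * δ * (r + 5) + 12)
    ≤⟨ +-mono-≤ (IH (skip-block₁ A)) (block₁-excess A) ⟩
  revMoment (λ i → f (skip4 4 i)) (4 + r) + _
    ≡⟨ sym (revMoment-skip4 f 4 (4 + r) (1 + r) refl) ⟩
  revMoment f (8 + r) ∎
  where open ≤-Reasoning
remove-block {δ} {f} .(11 + k) (late k) A IH = begin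
  minRevMoment δ (15 + k) + (4 * δ * (12 + k) + 12)
    ≤⟨ +-mono-≤ (IH (skip-block₂ A)) (block₂-excess A) ⟩
  revMoment (λ i → f (skip4 8 i)) (15 + k) + _
    ≡⟨ sym (revMoment-skip4 f 8 (15 + k) (8 + k) refl) ⟩
  revMoment f (19 + k) ∎
  where open ≤-Reasoning

minRevMoment≤revMoment : ∀ {δ f} R → Admissible δ f R → minRevMoment δ R ≤ revMoment f R
minRevMoment≤revMoment {δ} (suc (suc (suc (suc (suc (suc (suc (suc r)))))))) A =
  remove-block r (stepPhase δ r) A (minRevMoment≤revMoment (suc (suc (suc (suc r)))))
-- minRevMoment δ R unfolds to the sum of minimal prefix sums only for concrete R < 8.
minRevMoment≤revMoment 0 A = prefix-sums-bound A
minRevMoment≤revMoment 1 A = prefix-sums-bound A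
minRevMoment≤revMoment 2 A = prefix-sums-bound A
minRevMoment≤revMoment 3 A = prefix-sums-bound A
minRevMoment≤revMoment 4 A = prefix-sums-bound A
minRevMoment≤revMoment 5 A = prefix-sums-bound A
minRevMoment≤revMoment 6 A = prefix-sums-bound A
minRevMoment≤revMoment 7 A = prefix-sums-bound A

-- Comparison with Y

minRevMoment-tail : ∀ δ j k → j ≤ 3 →
  minRevMoment δ (15 + j + k * 4) + (3 + j) ≡ 4 * δ * (k + 2) * (2 * k + 6 + j) + 12 * k + 48 + j * j
minRevMoment-tail δ j (suc k) j≤3 = begin
  minRevMoment δ (15 + (j + (4 + k * 4))) + (3 + j)
    ≡⟨ cong (λ x → minRevMoment δ (15 + x) + (3 + j)) (x∙yz≈y∙xz j 4 (k * 4)) ⟩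
  minRevMoment δ (15 + j + k * 4) + (4 * δ * (12 + (j + k * 4)) + 12) + (3 + j)
    ≡⟨ xy∙z≈xz∙y (minRevMoment δ (15 + j + k * 4)) _ (3 + j) ⟩
  minRevMoment δ (15 + j + k * 4) + (3 + j) + (4 * δ * (12 + (j + k * 4)) + 12)
    ≡⟨ cong (_+ (4 * δ * (12 + (j + k * 4)) + 12)) (minRevMoment-tail δ j k j≤3) ⟩
  4 * δ * (k + 2) * (2 * k + 6 + j) + 12 * k + 48 + j * j + (4 * δ * (12 + (j + k * 4)) + 12)
    ≡⟨ next-block δ j k ⟩
  4 * δ * (1 + k + 2) * (2 * (1 + k) + 6 + j) + 12 * (1 + k) + 48 + j * j ∎
  where
    open ≡-Reasoning
    next-block : ∀ δ j k →
      4 * δ * (k + 2) * (2 * k + 6 + j) + 12 * k + 48 + j * j + (4 * δ * (12 + (j + k * 4)) + 12)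
        ≡ 4 * δ * (1 + k + 2) * (2 * (1 + k) + 6 + j) + 12 * (1 + k) + 48 + j * j
    next-block = solve-∀
minRevMoment-tail δ 0 zero _ = start δ
  where
    start : ∀ δ → 9 + 2 * δ + (2 * δ + 2) + (2 * δ + 2 + 2) + (2 * δ + 2 + 2 + 2) + (2 * δ * (3 + 5) + 12) + (2 * δ * (7 + 5) + 12) + (3 + 0)
                ≡ 4 * δ * (0 + 2) * (2 * 0 + 6 + 0) + 12 * 0 + 48 + 0 * 0
    start = solve-∀
minRevMoment-tail δ 1 zero _ = start δ
  where
    start : ∀ δ → 9 + 2 * δ + (2 * δ * (0 + 5) + 12) + (2 * δ * (4 + 5) + 12) + (2 * δ * (8 + 5) + 12) + (3 + 1)
                ≡ 4 * δ * (0 + 2) * (2 * 0 + 6 + 1) + 12 * 0 + 48 + 1 * 1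
    start = solve-∀
minRevMoment-tail δ 2 zero _ = start δ
  where
    start : ∀ δ → 9 + 2 * δ + (2 * δ + 2) + (2 * δ * (1 + 5) + 12) + (2 * δ * (5 + 5) + 12) + (2 * δ * (9 + 5) + 12) + (3 + 2)
                ≡ 4 * δ * (0 + 2) * (2 * 0 + 6 + 2) + 12 * 0 + 48 + 2 * 2
    start = solve-∀
minRevMoment-tail δ 3 zero _ = start δ
  where
    start : ∀ δ → 9 + 2 * δ + (2 * δ + 2) + (2 * δ + 2 + 2) + (2 * δ * (2 + 5) + 12) + (2 * δ * (6 + 5) + 12) + (2 * δ * (10 + 5) + 12) + (3 + 3)
                ≡ 4 * δ * (0 + 2) * (2 * 0 + 6 + 3) + 12 * 0 + 48 + 3 * 3
    start = solve-∀
minRevMoment-tail δ (suc (suc (suc (suc j)))) zero (s≤s (s≤s (s≤s ())))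

-- Ok r is the claim for sequences with last index r. It holds at the anchors 15 + j + 4P and
-- 19 + 4P + j (j ≤ 3) by the closed forms, and spreads in steps of 4: the jump
-- minRevMoment δ (4 + r) − minRevMoment δ r is at most 4n up to the last index 18 + 4P of Y
-- and at least 4n after it.
module _ (d P m : ℕ) (3δ≤m : 3 * suc d ≤ m) (m<7δ : m < 7 * suc d) where

  private
    δ N G : ℕ
    δ = suc d
    N = Ytotal δ P m
    G = gYformula δ P m

    Ok : ℕ → Set
    Ok r = r * N ≤ G + minRevMoment δ r

    ok-from-closed : ∀ r c L → minRevMoment δ r + c ≡ L → r * N + c ≤ G + L → Ok r
    ok-from-closed r c L eq h = +-cancelʳ-≤ c (r * N) (G + minRevMoment δ r)
      (≤-trans h (≤-reflexive (trans (cong (G +_) (sym eq)) (sym (+-assoc G _ c)))))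

    anchor-below : ∀ j → j ≤ 3 → Ok (15 + j + P * 4)
    anchor-below j j≤3 = ok-from-closed (15 + j + P * 4) (3 + j) _ (minRevMoment-tail δ j P j≤3) (slack j j≤3)
      where
        slack : ∀ j → j ≤ 3 → (15 + j + P * 4) * N + (3 + j)
                            ≤ G + (4 * δ * (P + 2) * (2 * P + 6 + j) + 12 * P + 48 + j * j)
        slack 0 _ = ≤-by-surplus (6 + 3 * m) (identity d P m)
          where
            identity : ∀ d P m →
              8 * (1 + d) * (P + 2) * (P + 2) + 20 * (1 + d) * (P + 2) + (4 * (P + 2) + 10) * m + 4 * (P + 2) + 13
                + (4 * (1 + d) * (P + 2) * (2 * P + 6 + 0) + 12 * P + 48 + 0 * 0)
              ≡ (15 + 0 + P * 4) * (4 * (1 + d) * (P + 2) + 4 + m) + (3 + 0) + (6 + 3 * m)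
            identity = solve-∀
        slack 1 _ = ≤-by-surplus (2 + 2 * m) (identity d P m)
          where
            identity : ∀ d P m →
              8 * (1 + d) * (P + 2) * (P + 2) + 20 * (1 + d) * (P + 2) + (4 * (P + 2) + 10) * m + 4 * (P + 2) + 13
                + (4 * (1 + d) * (P + 2) * (2 * P + 6 + 1) + 12 * P + 48 + 1 * 1)
              ≡ (15 + 1 + P * 4) * (4 * (1 + d) * (P + 2) + 4 + m) + (3 + 1) + (2 + 2 * m)
            identity = solve-∀
        slack 2 _ = ≤-by-surplus m (identity d P m)
          where
            identity : ∀ d P m →
              8 * (1 + d) * (P + 2) * (P + 2) + 20 * (1 + d) * (P + 2) + (4 * (P + 2) + 10) * m + 4 * (P + 2) + 13
                + (4 * (1 + d) * (P + 2) * (2 * P + 6 + 2) + 12 * P + 48 + 2 * 2)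
              ≡ (15 + 2 + P * 4) * (4 * (1 + d) * (P + 2) + 4 + m) + (3 + 2) + m
            identity = solve-∀
        slack 3 _ = ≤-by-surplus 0 (identity d P m)
          where
            identity : ∀ d P m →
              8 * (1 + d) * (P + 2) * (P + 2) + 20 * (1 + d) * (P + 2) + (4 * (P + 2) + 10) * m + 4 * (P + 2) + 13
                + (4 * (1 + d) * (P + 2) * (2 * P + 6 + 3) + 12 * P + 48 + 3 * 3)
              ≡ (15 + 3 + P * 4) * (4 * (1 + d) * (P + 2) + 4 + m) + (3 + 3) + 0
            identity = solve-∀
        slack (suc (suc (suc (suc j)))) (s≤s (s≤s (s≤s ())))

    anchor-above : ∀ j → j ≤ 3 → Ok (19 + P * 4 + j)
    anchor-above j j≤3 = subst Ok (shift j P)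
      (ok-from-closed (15 + j + suc P * 4) (3 + j) _ (minRevMoment-tail δ j (suc P) j≤3) (slack j j≤3))
      where
        shift : ∀ j P → 15 + j + (1 + P) * 4 ≡ 19 + P * 4 + j
        shift = solve-∀
        slack : ∀ j → j ≤ 3 → (15 + j + suc P * 4) * N + (3 + j)
                            ≤ G + (4 * δ * (suc P + 2) * (2 * suc P + 6 + j) + 12 * suc P + 48 + j * j)
        slack 0 _ = ≤-by-trade (12 + 9 * d) (identity d P m) (*-monoʳ-≤ 1 m<7δ)
          where
            identity : ∀ d P m →
              8 * (1 + d) * (P + 2) * (P + 2) + 20 * (1 + d) * (P + 2) + (4 * (P + 2) + 10) * m + 4 * (P + 2) + 13
                + (4 * (1 + d) * ((1 + P) + 2) * (2 * (1 + P) + 6 + 0) + 12 * (1 + P) + 48 + 0 * 0) + (1 + 0) * (1 + m)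
              ≡ (15 + 0 + (1 + P) * 4) * (4 * (1 + d) * (P + 2) + 4 + m) + (3 + 0) + ((1 + 0) * (7 * (1 + d)) + (12 + 9 * d))
            identity = solve-∀
        slack 1 _ = ≤-by-trade (6 + 6 * d) (identity d P m) (*-monoʳ-≤ 2 m<7δ)
          where
            identity : ∀ d P m →
              8 * (1 + d) * (P + 2) * (P + 2) + 20 * (1 + d) * (P + 2) + (4 * (P + 2) + 10) * m + 4 * (P + 2) + 13
                + (4 * (1 + d) * ((1 + P) + 2) * (2 * (1 + P) + 6 + 1) + 12 * (1 + P) + 48 + 1 * 1) + (1 + 1) * (1 + m)
              ≡ (15 + 1 + (1 + P) * 4) * (4 * (1 + d) * (P + 2) + 4 + m) + (3 + 1) + ((1 + 1) * (7 * (1 + d)) + (6 + 6 * d))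
            identity = solve-∀
        slack 2 _ = ≤-by-trade (2 + 3 * d) (identity d P m) (*-monoʳ-≤ 3 m<7δ)
          where
            identity : ∀ d P m →
              8 * (1 + d) * (P + 2) * (P + 2) + 20 * (1 + d) * (P + 2) + (4 * (P + 2) + 10) * m + 4 * (P + 2) + 13
                + (4 * (1 + d) * ((1 + P) + 2) * (2 * (1 + P) + 6 + 2) + 12 * (1 + P) + 48 + 2 * 2) + (1 + 2) * (1 + m)
              ≡ (15 + 2 + (1 + P) * 4) * (4 * (1 + d) * (P + 2) + 4 + m) + (3 + 2) + ((1 + 2) * (7 * (1 + d)) + (2 + 3 * d))
            identity = solve-∀
        slack 3 _ = ≤-by-trade 0 (identity d P m) (*-monoʳ-≤ 4 m<7δ)
          where
            identity : ∀ d P m →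
              8 * (1 + d) * (P + 2) * (P + 2) + 20 * (1 + d) * (P + 2) + (4 * (P + 2) + 10) * m + 4 * (P + 2) + 13
                + (4 * (1 + d) * ((1 + P) + 2) * (2 * (1 + P) + 6 + 3) + 12 * (1 + P) + 48 + 3 * 3) + (1 + 3) * (1 + m)
              ≡ (15 + 3 + (1 + P) * 4) * (4 * (1 + d) * (P + 2) + 4 + m) + (3 + 3) + ((1 + 3) * (7 * (1 + d)) + 0)
            identity = solve-∀
        slack (suc (suc (suc (suc j)))) (s≤s (s≤s (s≤s ())))

    minRevMoment₇≤4N : minRevMoment δ 7 ≤ 4 * N
    minRevMoment₇≤4N = ≤-by-surplus (16 * (1 + d) * P + 24 * d + 19 + 4 * m) (identity d P m)
      where
        identity : ∀ d P m → 4 * (4 * (1 + d) * (P + 2) + 4 + m) ≡ 9 + 2 * (1 + d) + (2 * (1 + d) + 2) + (2 * (1 + d) + 2 + 2) + (2 * (1 + d) + 2 + 2 + 2) + (16 * (1 + d) * P + 24 * d + 19 + 4 * m)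
        identity = solve-∀

    step≤4N : ∀ r → 8 + r ≤ 18 + P * 4 → step δ r ≤ 4 * N
    step≤4N r 8+r≤ with stepPhase δ r
    ... | early r≤10 step≡ = begin
      step δ r                         ≡⟨ step≡ ⟩
      2 * δ * (r + 5) + 12             ≤⟨ +-monoˡ-≤ 12 (*-monoʳ-≤ (2 * δ) (+-monoˡ-≤ 5 r≤10)) ⟩
      2 * δ * (10 + 5) + 12            ≤⟨ ≤-by-surplus (16 * (1 + d) * P + 2 * (1 + d) + 4 + 4 * m) (identity d P m) ⟩
      4 * N                            ∎
      where
        open ≤-Reasoning
        identity : ∀ d P m → 4 * (4 * (1 + d) * (P + 2) + 4 + m) ≡ 2 * (1 + d) * (10 + 5) + 12 + (16 * (1 + d) * P + 2 * (1 + d) + 4 + 4 * m)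
        identity = solve-∀
    ... | late k = begin
      4 * δ * (12 + k) + 12            ≤⟨ +-monoˡ-≤ 12 (*-monoʳ-≤ (4 * δ) (+-monoʳ-≤ 11 (+-cancelˡ-≤ 18 (suc k) (P * 4) 8+r≤))) ⟩
      4 * δ * (11 + P * 4) + 12        ≤⟨ ≤-by-trade 4 (identity d P m) (*-monoʳ-≤ 4 3δ≤m) ⟩
      4 * N                            ∎
      where
        open ≤-Reasoning
        identity : ∀ d P m → 4 * (4 * (1 + d) * (P + 2) + 4 + m) + 4 * (3 * (1 + d)) ≡ 4 * (1 + d) * (11 + P * 4) + 12 + (4 * m + 4)
        identity = solve-∀

    jump-below : ∀ r → 4 + r ≤ 18 + P * 4 → minRevMoment δ (4 + r) ≤ minRevMoment δ r + 4 * N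
    jump-below 0 _ = ≤-trans (sumBelow-≤-+ (λ k → minPrefix δ (suc k)) 4 3) minRevMoment₇≤4N
    jump-below 1 _ = ≤-trans (sumBelow-≤-+ (λ k → minPrefix δ (suc k)) 5 2) (≤-trans minRevMoment₇≤4N (m≤n+m _ 1))
    jump-below 2 _ = ≤-trans (sumBelow-≤-+ (λ k → minPrefix δ (suc k)) 6 1) (≤-trans minRevMoment₇≤4N (m≤n+m _ 4))
    jump-below 3 _ = ≤-trans minRevMoment₇≤4N (m≤n+m _ 9)
    jump-below (suc (suc (suc (suc r)))) 8+r≤ = +-monoʳ-≤ (minRevMoment δ (4 + r)) (step≤4N r 8+r≤)

    jump-above : ∀ e → minRevMoment δ (19 + P * 4 + e) + 4 * N ≤ minRevMoment δ (4 + (19 + P * 4 + e))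
    jump-above e = +-monoʳ-≤ (minRevMoment δ (19 + P * 4 + e)) (begin
      4 * N                                ≤⟨ ≤-by-trade (4 * δ) (identity d P m) (*-monoʳ-≤ 4 m<7δ) ⟩
      4 * δ * (16 + P * 4) + 12            ≤⟨ +-monoˡ-≤ 12 (*-monoʳ-≤ (4 * δ) (+-monoʳ-≤ 16 (m≤m+n (P * 4) e))) ⟩
      4 * δ * (16 + (P * 4 + e)) + 12      ∎)
      where
        open ≤-Reasoning
        identity : ∀ d P m → 4 * (1 + d) * (16 + P * 4) + 12 + 4 * (1 + m) ≡ 4 * (4 * (1 + d) * (P + 2) + 4 + m) + (4 * (7 * (1 + d)) + 4 * (1 + d))
        identity = solve-∀

    4+r*N : ∀ r N → (4 + r) * N ≡ r * N + 4 * N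
    4+r*N = solve-∀

    ok-down : ∀ r → minRevMoment δ (4 + r) ≤ minRevMoment δ r + 4 * N → Ok (4 + r) → Ok r
    ok-down r jump ok = +-cancelʳ-≤ (4 * N) (r * N) (G + minRevMoment δ r) (begin
      r * N + 4 * N                        ≡⟨ sym (4+r*N r N) ⟩
      (4 + r) * N                          ≤⟨ ok ⟩
      G + minRevMoment δ (4 + r)           ≤⟨ +-monoʳ-≤ G jump ⟩
      G + (minRevMoment δ r + 4 * N)       ≡⟨ sym (+-assoc G _ (4 * N)) ⟩
      G + minRevMoment δ r + 4 * N         ∎)
      where open ≤-Reasoning

    ok-up : ∀ r → minRevMoment δ r + 4 * N ≤ minRevMoment δ (4 + r) → Ok r → Ok (4 + r)
    ok-up r jump ok = begin
      (4 + r) * N                          ≡⟨ 4+r*N r N ⟩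
      r * N + 4 * N                        ≤⟨ +-monoˡ-≤ (4 * N) ok ⟩
      G + minRevMoment δ r + 4 * N         ≡⟨ +-assoc G _ (4 * N) ⟩
      G + (minRevMoment δ r + 4 * N)       ≤⟨ +-monoʳ-≤ G jump ⟩
      G + minRevMoment δ (4 + r)           ∎
      where open ≤-Reasoning

    anchor-at : ∀ j e r → j + e ≡ 3 → r + e ≡ 18 + P * 4 → Ok r
    anchor-at j e r j+e≡3 r+e≡ = subst Ok (sym r≡) (anchor-below j (subst (j ≤_) j+e≡3 (m≤m+n j e)))
      where
        regroup : ∀ j e X → 15 + (j + e) + X ≡ 15 + j + X + e
        regroup = solve-∀
        r≡ : r ≡ 15 + j + P * 4
        r≡ = +-cancelʳ-≡ e r _ (trans r+e≡ (trans (cong (λ x → 15 + x + P * 4) (sym j+e≡3)) (regroup j e (P * 4))))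

    ok-below : ∀ e r → r + e ≡ 18 + P * 4 → Ok r
    ok-below 0 r r+e≡ = anchor-at 3 0 r refl r+e≡
    ok-below 1 r r+e≡ = anchor-at 2 1 r refl r+e≡
    ok-below 2 r r+e≡ = anchor-at 1 2 r refl r+e≡
    ok-below 3 r r+e≡ = anchor-at 0 3 r refl r+e≡
    ok-below (suc (suc (suc (suc e)))) r r+e≡ =
      ok-down r (jump-below r (≤-trans (m≤m+n (4 + r) e) (≤-reflexive 4+r+e≡))) (ok-below e (4 + r) 4+r+e≡)
      where
        4+r+e≡ : 4 + r + e ≡ 18 + P * 4
        4+r+e≡ = trans (sym (x∙yz≈y∙xz r 4 e)) r+e≡

    ok-above : ∀ e → Ok (19 + P * 4 + e)
    ok-above 0 = anchor-above 0 z≤n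
    ok-above 1 = anchor-above 1 (s≤s z≤n)
    ok-above 2 = anchor-above 2 (s≤s (s≤s z≤n))
    ok-above 3 = anchor-above 3 (s≤s (s≤s (s≤s z≤n)))
    ok-above (suc (suc (suc (suc e)))) =
      subst Ok (sym (x∙yz≈y∙xz (19 + P * 4) 4 e)) (ok-up _ (jump-above e) (ok-above e))

  r*Ytotal≤gY+minRevMoment : ∀ r → r * Ytotal (suc d) P m ≤ gYformula (suc d) P m + minRevMoment (suc d) r
  r*Ytotal≤gY+minRevMoment r with r ≤? 18 + P * 4
  ... | yes r≤ = ok-below (18 + P * 4 ∸ r) r (m+[n∸m]≡n r≤)
  ... | no  r≰ = subst Ok (m+[n∸m]≡n (≰⇒> r≰)) (ok-above (r ∸ (19 + P * 4)))

lastNonzero : (ℕ → ℕ) → ℕ → ℕ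
lastNonzero f zero    = zero
lastNonzero f (suc k) with f (suc k)
... | zero  = lastNonzero f k
... | suc _ = suc k

lastNonzero-≤ : ∀ f N → lastNonzero f N ≤ N
lastNonzero-≤ f zero    = z≤n
lastNonzero-≤ f (suc k) with f (suc k)
... | zero  = m≤n⇒m≤1+n (lastNonzero-≤ f k)
... | suc _ = ≤-refl

lastNonzero-vanishes : ∀ f N i → lastNonzero f N < i → i ≤ N → f i ≡ 0
lastNonzero-vanishes f zero    i last<i i≤0 = ⊥-elim (<⇒≱ last<i (≤-trans i≤0 z≤n))
lastNonzero-vanishes f (suc k) i last<i i≤N with f (suc k) in fN≡
... | suc _ = ⊥-elim (<⇒≱ last<i i≤N)
... | zero with m≤n⇒m<n∨m≡n i≤N
...   | inj₁ i<N  = lastNonzero-vanishes f k i last<i (≤-pred i<N)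
...   | inj₂ refl = fN≡

lastNonzero-nonzero : ∀ f N → lastNonzero f N ≡ 0 ⊎ 0 < f (lastNonzero f N)
lastNonzero-nonzero f zero    = inj₁ refl
lastNonzero-nonzero f (suc k) with f (suc k) in fN≡
... | zero  = lastNonzero-nonzero f k
... | suc _ = inj₂ (subst (0 <_) (sym fN≡) (s≤s z≤n))

at-beyond-lastNonzero : ∀ x xs i → lastNonzero (at (x ∷ xs)) (length xs) < i → at (x ∷ xs) i ≡ 0
at-beyond-lastNonzero x xs i last<i with i ≤? length xs
... | yes i≤L = lastNonzero-vanishes (at (x ∷ xs)) (length xs) i last<i i≤L
... | no  i≰L = at-≥length (x ∷ xs) i (≰⇒> i≰L)

window≡blockSum : ∀ f j → f (1 + j * 4 ∸ 1) + f (1 + j * 4) + f (1 + j * 4 + 1) + f (1 + j * 4 + 2) ≡ blockSum f j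
window≡blockSum f j =
  cong₂ (λ a b → f (j * 4) + f (1 + j * 4) + f a + f b) (+-comm (1 + j * 4) 1) (+-comm (1 + j * 4) 2)

admissible-lastNonzero : ∀ {δ} f L → f 0 ≡ 1 →
  (∀ i → 0 < i → 0 < f i → ∀ j → 1 ≤ j → j ≤ i ∸ 1 → 2 ≤ f j) →
  (∀ i → 1 ≤ i → i ≤ L ∸ 1 → i % 4 ≡ 1 → 2 * δ ≤ f (i ∸ 1) + f i + f (i + 1) + f (i + 2)) →
  (∀ i → 9 ≤ i → i + 10 ≤ L → i % 4 ≡ 1 → 4 * δ ≤ f (i ∸ 1) + f i + f (i + 1) + f (i + 2)) →
  Admissible δ f (lastNonzero f L)
admissible-lastNonzero {δ} f L f₀≡1 twos windows₂δ windows₄δ = record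
  { head≡1   = f₀≡1
  ; inner≥2  = inner
  ; block≥2δ = λ j h → subst (2 * δ ≤_) (window≡blockSum f j)
      (windows₂δ (1 + j * 4) (s≤s z≤n) (∸-monoˡ-≤ 1 (≤-trans h R≤L)) ([m+kn]%n≡m%n 1 j 4))
  ; block≥4δ = λ j h → subst (4 * δ ≤_) (window≡blockSum f (2 + j))
      (windows₄δ (1 + (2 + j) * 4) (m≤m+n 9 (j * 4))
        (≤-trans (≤-reflexive (+-comm (1 + (2 + j) * 4) 10)) (≤-trans h R≤L)) ([m+kn]%n≡m%n 1 (2 + j) 4))
  }
  where
    R : ℕ
    R = lastNonzero f L
    R≤L : R ≤ L
    R≤L = lastNonzero-≤ f L
    inner : ∀ j → 1 ≤ j → j < R → 2 ≤ f j
    inner j 1≤j j<R with lastNonzero-nonzero f L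
    ... | inj₁ R≡0   = ⊥-elim (<⇒≱ (subst (j <_) R≡0 j<R) z≤n)
    ... | inj₂ 0<f-R = twos R (≤-trans 1≤j (<⇒≤ j<R)) 0<f-R j 1≤j (∸-monoˡ-≤ 1 j<R)

lemma4p5 : (n δ : ℕ) → n > 15 * δ + 3 → 4 ≤ δ →
    (X : List ℕ) →
    let r = length X ∸ 1 in
    at X 0 ≡ 1 →
    total X ≡ n →
    (∀ i → 0 < i → 0 < at X i → ∀ j → 1 ≤ j → j ≤ i ∸ 1 → 2 ≤ at X j) →
    (∀ i → 1 ≤ i → i ≤ r ∸ 1 → i % 4 ≡ 1 →
      2 * δ ≤ at X (i ∸ 1) + at X i + at X (i + 1) + at X (i + 2)) →
    (∀ i → 9 ≤ i → i + 10 ≤ r → i % 4 ≡ 1 →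
      4 * δ ≤ at X (i ∸ 1) + at X i + at X (i + 1) + at X (i + 2)) →
    g X ≤ g (Y n δ)
lemma4p5 n δ _ _ [] () _ _ _ _
lemma4p5 n _ n> (s≤s (s≤s (s≤s (s≤s (z≤n {d}))))) X@(x ∷ xs) head≡1 total≡n twos windows₂δ windows₄δ =
  +-cancelʳ-≤ (minRevMoment δ R) (g X) (g (Y n δ)) (begin
    g X + minRevMoment δ R
      ≤⟨ +-monoʳ-≤ (g X) (minRevMoment≤revMoment R admissible) ⟩
    g X + revMoment (at X) R
      ≡⟨ g+revMoment X R (s≤s (lastNonzero-≤ (at X) (length xs))) (at-beyond-lastNonzero x xs) ⟩
    R * total X
      ≡⟨ cong (R *_) (trans total≡n n≡Ytotal) ⟩
    R * Ytotal δ (pY n δ) (mY n δ)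
      ≤⟨ r*Ytotal≤gY+minRevMoment (3 + d) (pY n δ) (mY n δ) 3δ≤m m<7δ R ⟩
    gYformula δ (pY n δ) (mY n δ) + minRevMoment δ R
      ≡⟨ cong (_+ minRevMoment δ R) (sym (g-Y n (1 + d))) ⟩
    g (Y n δ) + minRevMoment δ R ∎)
  where
    open ≤-Reasoning
    δ R : ℕ
    δ = 4 + d
    R = lastNonzero (at X) (length xs)
    open YParameters (yParameters n (3 + d) n>)
    admissible : Admissible δ (at X) R
    admissible = admissible-lastNonzero (at X) (length xs) head≡1 twos windows₂δ windows₄δ
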